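{- Consider any execution of the procedure Explore described below on a finite unfolding $\mathfrak U$. Its call graph $(B,\triangleright)$ is a finite binary tree rooted at $(\{\bot\},\emptyset,\emptyset,\bot)$, in which $\triangleright_l$ is the left-child relation and $\triangleright_r$ the right-child relation.
   Context: $\mathfrak U=(E,<,\#,h)$ is a finite labelled event structure (causality $<$ a strict partial order, conflict $\#$ symmetric irreflexive and inherited along $<$) with a minimal event $\bot$ (the unfolding of a system under an independence relation); a configuration is a finite causally closed conflict-free set of events; $[e]=\{e'\le e\}$, $\lceil e\rceil=\{e'<e\}$; $e\#_ie'$ if $e\#e'$ and both $\lceil e\rceil\cup[e']$ and $[e]\cup\lceil e'\rceil$ are configurations. $\mathrm{ex}(C)=\{e\notin C:\lceil e\rceil\subseteq C\}$, $\mathrm{en}(C)=\{e\in\mathrm{ex}(C):C\cup\{e\}\text{ a configuration}\}$. For $U\subseteq E$, $\#_U(e)=\{e'\in U:e\#_ie'\}$, $Q_{C,D,U}=C\cup D\cup\bigcup_{e\in C\cup D,\,e'\in\#_U(e)}[e']$. An alternative to $D$ after $C$ (w.r.t. $U$) is a configuration $J\subseteq U$ with $C\cup J$ a configuration and, for each $e\in D$, some $e'\in C\cup J$ in $\#_U(e)$; $\mathrm{Alt}(X,Y)$ is the set of all alternatives to $Y$ after $X$ w.r.t. the current $U$. Algorithm: global $U$ (initially $\{\bot\}$), $G$ (initially $\emptyset$); start with $\mathrm{Explore}(\{\bot\},\emptyset,\emptyset)$. $\mathrm{Explore}(C,D,A)$: (1) add $\mathrm{ex}(C)$ to $U$; (2)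 if $\mathrm{en}(C)\cap U=\emptyset$, return; (3) if $A=\emptyset$ choose any $e\in\mathrm{en}(C)\cap U$, else any $e\in A\cap\mathrm{en}(C)\cap U$; (4) call $\mathrm{Explore}(C\cup\{e\},D,A\setminus\{e\})$; (5) if some $J\in\mathrm{Alt}(C,D\cup\{e\})$ exists, call $\mathrm{Explore}(C,D\cup\{e\},J\setminus C)$; (6) move $\{e\}\setminus Q_{C,D,U}$ from $U$ to $G$ and, for each $\hat e\in\#_U(e)$, move $[\hat e]\setminus Q_{C,D,U}$ from $U$ to $G$. Call graph: $B$ is the set of tuples $(C,D,A,e)$ such that $\mathrm{Explore}(C,D,A)$ was called and $e$ is the event chosen in step (3) (or $\bot$ if the call returned at step (2)); $b\triangleright_l b'$ (resp. $\triangleright_r$) if the call of $b$ issues the call of $b'$ at step (4) (resp. (5)); $\triangleright=\triangleright_l\cup\triangleright_r$. -}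

module Defs where

open import Data.Nat using (ℕ)
open import Data.Fin using (Fin)
open import Data.Fin.Subset
  using (Subset; _∈_; _∉_; _⊆_; _∪_; _─_; _-_; ⁅_⁆; Empty)
  renaming (⊥ to ∅)
open import Data.Product using (Σ; ∃; ∃-syntax; _×_; _,_)
open import Data.Sum using (_⊎_)
open import Data.List using (List; []; _∷_)
open import Data.List.Membership.Propositional using () renaming (_∈_ to _∈ₗ_)
open import Data.Maybe using (Maybe; just; nothing)
open import Data.Empty renaming (⊥ to False)
open import Relation.Nullary using (¬_; Dec)
open import Relation.Binary.PropositionalEquality using (_≡_; _≢_)
open import Relation.Binary.Construct.Closure.ReflexiveTransitive using (Star)
open import Induction.WellFounded using (Acc)

record EventStructure : Set₁ where
  field
    n       : ℕ
    Label   : Set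
    h       : Fin n → Label
    _≺_     : Fin n → Fin n → Set
    _#_     : Fin n → Fin n → Set
    ≺-dec   : ∀ e e' → Dec (e ≺ e')
    #-dec   : ∀ e e' → Dec (e # e')
    ≺-irrefl : ∀ e → ¬ (e ≺ e)
    ≺-trans  : ∀ {e e' e''} → e ≺ e' → e' ≺ e'' → e ≺ e''
    #-irrefl : ∀ e → ¬ (e # e)
    #-sym    : ∀ {e e'} → e # e' → e' # e
    #-inh    : ∀ {e e' e''} → e # e' → e' ≺ e'' → e # e''
    bot      : Fin n
    bot-least : ∀ e → e ≢ bot → bot ≺ e

module Explore (𝔘 : EventStructure) where
  open EventStructure 𝔘

  Ev : Set
  Ev = Fin n

  _≼_ : Ev → Ev → Set
  e' ≼ e = e' ≡ e ⊎ e' ≺ e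

  -- configuration, for an arbitrary predicate on events
  -- (finiteness is automatic since E is finite)
  IsConfigP : (Ev → Set) → Set
  IsConfigP P = (∀ e e' → P e → e' ≺ e → P e')
              × (∀ e e' → P e → P e' → ¬ (e # e'))

  IsConfig : Subset n → Set
  IsConfig C = IsConfigP (_∈ C)

  _#ᵢ_ : Ev → Ev → Set
  e #ᵢ e' = e # e'
          × IsConfigP (λ x → x ≺ e ⊎ x ≼ e')
          × IsConfigP (λ x → x ≼ e ⊎ x ≺ e')

  ex : Subset n → Ev → Set
  ex C e = e ∉ C × (∀ e' → e' ≺ e → e' ∈ C)

  en : Subset n → Ev → Set
  en C e = ex C e × IsConfigP (λ x → x ∈ C ⊎ x ≡ e)

  #[_] : Subset n → Ev → Ev → Set
  #[ U ] e e' = e' ∈ U × e #ᵢ e'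

  Q : Subset n → Subset n → Subset n → Ev → Set
  Q C D U x = x ∈ C ⊎ x ∈ D
            ⊎ ∃[ e ] ∃[ e' ] ((e ∈ C ⊎ e ∈ D) × #[ U ] e e' × x ≼ e')

  Alt : Subset n → Subset n → Subset n → Subset n → Set
  Alt U C D J = J ⊆ U × IsConfig J × IsConfig (C ∪ J)
              × (∀ e → e ∈ D → ∃[ e' ] ((e' ∈ C ⊎ e' ∈ J) × #[ U ] e e'))

  _≐_ : Subset n → (Ev → Set) → Set
  S ≐ P = ∀ x → (x ∈ S → P x) × (P x → x ∈ S)

  -- Small-step semantics of the (nondeterministic) recursive procedure,
  -- with global U, G, an explicit call stack, and a log of the call graph.

  Tuple : Set
  Tuple = Subset n × Subset n × Subset n × Ev

  data Side : Set where
    left right : Side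

  data Phase : Set where
    entry  : Maybe (Tuple × Side) → Phase  -- fresh call, with its caller's node
                                           -- and the step (4)=left / (5)=right
    afterL : Ev → Phase                    -- step (4) returned, e chosen
    afterR : Ev → Phase                    -- step (5) done, e chosen

  record Frame : Set where
    constructor frame
    field
      fC fD fA : Subset n
      phase    : Phase

  record State : Set where
    constructor state
    field
      U G    : Subset n
      stack  : List Frame
      nodes  : List Tuple
      edgesL : List (Tuple × Tuple)
      edgesR : List (Tuple × Tuple)

  open Frame public
  open State public

  logL : Maybe (Tuple × Side) → Tuple → List (Tuple × Tuple) → List (Tuple × Tuple)
  logL (just (p , left)) t es = (p , t) ∷ es
  logL _                 t es = es

  logR : Maybe (Tuple × Side) → Tuple → List (Tuple × Tuple) → List (Tuple × Tuple)
  logR (just (p , right)) t es = (p , t) ∷ es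
  logR _                  t es = es

  -- the event chosen at step (3)
  Choosable : Subset n → Subset n → Subset n → Ev → Set
  Choosable U C A e = (Empty A → en C e × e ∈ U)
                    × (¬ Empty A → e ∈ A × en C e × e ∈ U)

  -- events moved from U to G at step (6)
  -- (Q_{C,D,U} and #_U(e) taken w.r.t. U at the start of step (6))
  Moved : Subset n → Subset n → Subset n → Ev → Ev → Set
  Moved U C D e x = ¬ Q C D U x × (x ≡ e ⊎ ∃[ ê ] (#[ U ] e ê × x ≼ ê))

  data _⟶_ : State → State → Set where
    -- steps (1),(2): nothing enabled in U, return
    step-return : ∀ {U U' G C D A p fs B L R} →
      U' ≐ (λ x → x ∈ U ⊎ ex C x) →
      (∀ e → en C e → e ∈ U' → False) →
      state U G (frame C D A (entry p) ∷ fs) B L R ⟶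
      state U' G fs ((C , D , A , bot) ∷ B)
            (logL p (C , D , A , bot) L) (logR p (C , D , A , bot) R)
    -- steps (1),(3),(4): choose e and call Explore(C ∪ {e}, D, A ∖ {e})
    step-left : ∀ {U U' G C D A p fs B L R} e →
      U' ≐ (λ x → x ∈ U ⊎ ex C x) →
      Choosable U' C A e →
      state U G (frame C D A (entry p) ∷ fs) B L R ⟶
      state U' G (frame (C ∪ ⁅ e ⁆) D (A - e) (entry (just ((C , D , A , e) , left)))
                  ∷ frame C D A (afterL e) ∷ fs)
            ((C , D , A , e) ∷ B)
            (logL p (C , D , A , e) L) (logR p (C , D , A , e) R)
    -- step (5), an alternative J exists: call Explore(C, D ∪ {e}, J ∖ C)
    step-right : ∀ {U G C D A e fs B L R} J →
      Alt U C (D ∪ ⁅ e ⁆) J →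
      state U G (frame C D A (afterL e) ∷ fs) B L R ⟶
      state U G (frame C (D ∪ ⁅ e ⁆) (J ─ C) (entry (just ((C , D , A , e) , right)))
                 ∷ frame C D A (afterR e) ∷ fs) B L R
    -- step (5), no alternative
    step-noalt : ∀ {U G C D A e fs B L R} →
      (∀ J → Alt U C (D ∪ ⁅ e ⁆) J → False) →
      state U G (frame C D A (afterL e) ∷ fs) B L R ⟶
      state U G (frame C D A (afterR e) ∷ fs) B L R
    -- step (6) and return
    step-cleanup : ∀ {U U' G G' C D A e fs B L R} →
      U' ≐ (λ x → x ∈ U × ¬ Moved U C D e x) →
      G' ≐ (λ x → x ∈ G ⊎ (x ∈ U × Moved U C D e x)) →
      state U G (frame C D A (afterR e) ∷ fs) B L R ⟶
      state U' G' fs B L R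

  initial : State
  initial = state ⁅ bot ⁆ ∅ (frame ⁅ bot ⁆ ∅ ∅ (entry nothing) ∷ []) [] [] []

  Reachable : State → Set
  Reachable = Star _⟶_ initial

  Finished : State → Set
  Finished s = stack s ≡ []

  AllExecutionsFinite : Set
  AllExecutionsFinite = Acc (λ s' s → s ⟶ s') initial

  module _ (B : List Tuple) (L R : List (Tuple × Tuple)) where
    _▷ₗ_ _▷ᵣ_ _▷_ : Tuple → Tuple → Set
    b ▷ₗ b' = (b , b') ∈ₗ L
    b ▷ᵣ b' = (b , b') ∈ₗ R
    b ▷ b'  = b ▷ₗ b' ⊎ b ▷ᵣ b'

    record IsBinaryTree (r : Tuple) : Set where
      field
        root∈      : r ∈ₗ B
        src∈       : ∀ b b' → b ▷ b' → b ∈ₗ B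
        tgt∈       : ∀ b b' → b ▷ b' → b' ∈ₗ B
        root-noparent : ∀ b → ¬ (b ▷ r)
        parent     : ∀ b' → b' ∈ₗ B → b' ≢ r → ∃[ b ] (b ▷ b')
        parent-unique : ∀ b₁ b₂ b' → b₁ ▷ b' → b₂ ▷ b' → b₁ ≡ b₂
        not-both   : ∀ b b' → b ▷ₗ b' → ¬ (b ▷ᵣ b')
        left-unique  : ∀ b b₁ b₂ → b ▷ₗ b₁ → b ▷ₗ b₂ → b₁ ≡ b₂
        right-unique : ∀ b b₁ b₂ → b ▷ᵣ b₁ → b ▷ᵣ b₂ → b₁ ≡ b₂
        reachable  : ∀ b → b ∈ₗ B → Star _▷_ r b

-- Every call Explore(C, D, A) satisfies: each event of D conflicts with an
-- event of C ∪ A, and C ∪ A is conflict-free.  Hence the event chosen at step (3) lies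
-- neither in C nor in D, so both recursive calls strictly decrease the slack
-- ∣∁C∣ + ∣∁D∣, and a budget exponential in the slack bounds the work left on the stack.
--
-- Every call logs one node, linked to its caller's node on the correct
-- side, so (B, ▷) is a binary tree as soon as no node is logged twice.  A node is
-- identified by its key (C, D).  The keys a stack frame may still log all extend its
-- own (C, D) (C grows, D grows, and C never meets the original D); the left subcall
-- after choosing e only logs keys with e ∈ C, the right subcall only keys with e ∉ C.
-- So the futures of the frames on the stack are pairwise disjoint and avoid every key
-- logged so far, which makes each newly logged key fresh.

module Submission where

open import Defs
open import Data.Product using (_×_; ∃-syntax; _,_)
open import Data.Fin.Subset using (⁅_⁆) renaming (⊥ to ∅)

open import Data.Nat using (ℕ; zero; suc; _+_; _<_; _≤_; s≤s; z≤n; s≤s⁻¹)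
open import Data.Nat.Properties
  using (≤-refl; ≤-reflexive; <-≤-trans; +-assoc; +-suc; +-mono-≤; +-monoˡ-<; +-monoʳ-<;
         m≤n+m; m<n+m)
open import Data.Fin using (_≟_)
open import Data.Fin.Subset using (Subset; _∈_; _∉_; _⊆_; _∪_; _─_; _-_; ∁; ∣_∣; Empty)
open import Data.Fin.Subset.Properties
  using (p⊂q⇒∣p∣<∣q∣; p⊂q⇒∁p⊃∁q; p⊆p∪q; x∈p∪q⁺; x∈p∪q⁻; x∈⁅x⁆; x∈⁅y⁆⇒x≡y; x≢y⇒x∉⁅y⁆;
         ∉⊥; p─q⊆p; x∈p∧x∉q⇒x∈p─q; _∈?_; nonempty?)
open import Data.Product using (proj₁; proj₂)
import Data.Product as Product
open import Data.Sum using (_⊎_; inj₁; inj₂; swap)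
import Data.Sum as Sum
open import Data.List using (List; []; _∷_; map)
open import Data.Nat.ListAction using (sum)
open import Data.List.Relation.Unary.Any using (here; there)
open import Data.List.Relation.Unary.All using (All; []; _∷_)
import Data.List.Relation.Unary.All as All
open import Data.List.Relation.Unary.AllPairs using (AllPairs; []; _∷_)
import Data.List.Relation.Unary.AllPairs as AllPairs
open import Data.List.Membership.Propositional using () renaming (_∈_ to _∈ₗ_)
open import Data.Maybe using (just; nothing)
open import Data.Empty using (⊥; ⊥-elim)
open import Data.Unit using (⊤; tt)
open import Relation.Nullary using (¬_; yes; no)
open import Relation.Binary.PropositionalEquality using (_≡_; _≢_; refl; sym; trans; subst)
open import Relation.Binary.Construct.Closure.ReflexiveTransitive using (Star; ε; _◅_; _◅◅_)
import Relation.Binary.Construct.Closure.ReflexiveTransitive as Star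
open import Induction.WellFounded using (Acc; acc)

∣∁p∪⁅x⁆∣<∣∁p∣ : ∀ {m} {p : Subset m} {x} → x ∉ p → ∣ ∁ (p ∪ ⁅ x ⁆) ∣ < ∣ ∁ p ∣
∣∁p∪⁅x⁆∣<∣∁p∣ {x = x} x∉p =
  p⊂q⇒∣p∣<∣q∣ (p⊂q⇒∁p⊃∁q (p⊆p∪q ⁅ x ⁆ , x , x∈p∪q⁺ (inj₂ (x∈⁅x⁆ x)) , x∉p))

-- A call of slack k + 1 is replaced by a call of slack ≤ k and a frame costing
-- 2 + budget k (its pending step (5), itself a call of slack ≤ k, plus step (6)).
budget : ℕ → ℕ
budget zero    = 1
budget (suc k) = suc (budget k + (2 + budget k))

budget-pos : ∀ k → 0 < budget k
budget-pos zero    = s≤s z≤n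
budget-pos (suc k) = s≤s z≤n

budget-mono : ∀ {j k} → j ≤ k → budget j ≤ budget k
budget-mono {k = k} z≤n       = budget-pos k
budget-mono (s≤s j≤k) = s≤s (+-mono-≤ (budget-mono j≤k) (s≤s (s≤s (budget-mono j≤k))))

budget-split : ∀ {a b k} → a < k → b < k → budget a + (2 + budget b) < budget k
budget-split (s≤s a≤k) (s≤s b≤k) =
  s≤s (+-mono-≤ (budget-mono a≤k) (s≤s (s≤s (budget-mono b≤k))))

module CallGraph (𝔘 : EventStructure) where
  open EventStructure 𝔘
  open Explore 𝔘

  ConflictFree : (Ev → Set) → Set
  ConflictFree P = ∀ {x y} → P x → P y → ¬ (x # y)

  record WellFormedCall (C D A : Subset n) : Set where
    field
      refuted      : ∀ {d} → d ∈ D → ∃[ c ] ((c ∈ C ⊎ c ∈ A) × d # c)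
      conflictFree : ConflictFree (λ x → x ∈ C ⊎ x ∈ A)

    ∈C⇒∉D : ∀ {x} → x ∈ C → x ∉ D
    ∈C⇒∉D x∈C x∈D = let c , c∈ , x#c = refuted x∈D in conflictFree (inj₁ x∈C) c∈ x#c

  open WellFormedCall

  choosable-cases : ∀ {U C A e} → Choosable U C A e → en C e × (e ∈ A ⊎ Empty A)
  choosable-cases {A = A} (ifEmpty , ifNonempty) with nonempty? A
  ... | yes nonempty = let e∈A , enabled , _ = ifNonempty (λ empty → empty nonempty)
                       in enabled , inj₁ e∈A
  ... | no empty     = proj₁ (ifEmpty empty) , inj₂ empty

  chosen∉C : ∀ {U C A e} → Choosable U C A e → e ∉ C
  chosen∉C ch = proj₁ (proj₁ (proj₁ (choosable-cases ch)))

  module Chosen {U C D A e} (wf : WellFormedCall C D A) (ch : Choosable U C A e) where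

    conflictFree-chosen : ConflictFree (λ x → (x ∈ C ⊎ x ∈ A) ⊎ x ≡ e)
    conflictFree-chosen with choosable-cases ch
    ... | _ , inj₁ e∈A = λ px py → conflictFree wf (absorb px) (absorb py)
      where
        absorb : ∀ {x} → (x ∈ C ⊎ x ∈ A) ⊎ x ≡ e → x ∈ C ⊎ x ∈ A
        absorb (inj₁ x∈C∪A) = x∈C∪A
        absorb (inj₂ refl)  = inj₂ e∈A
    ... | (_ , C∪e-config) , inj₂ A-empty = λ px py → proj₂ C∪e-config _ _ (dropA px) (dropA py)
      where
        dropA : ∀ {x} → (x ∈ C ⊎ x ∈ A) ⊎ x ≡ e → x ∈ C ⊎ x ≡ e
        dropA (inj₁ (inj₁ x∈C)) = inj₁ x∈C
        dropA (inj₁ (inj₂ x∈A)) = ⊥-elim (A-empty (_ , x∈A))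
        dropA (inj₂ x≡e)        = inj₂ x≡e

    chosen∉D : e ∉ D
    chosen∉D e∈D = let c , c∈ , e#c = refuted wf e∈D in conflictFree-chosen (inj₂ refl) (inj₁ c∈) e#c

    wellFormed-left : WellFormedCall (C ∪ ⁅ e ⁆) D (A - e)
    wellFormed-left = record
      { refuted      = λ d∈D → let c , c∈ , d#c = refuted wf d∈D in c , toNew c∈ , d#c
      ; conflictFree = λ px py → conflictFree-chosen (toOld px) (toOld py)
      }
      where
        toNew : ∀ {x} → x ∈ C ⊎ x ∈ A → x ∈ C ∪ ⁅ e ⁆ ⊎ x ∈ A - e
        toNew (inj₁ x∈C) = inj₁ (x∈p∪q⁺ (inj₁ x∈C))
        toNew {x} (inj₂ x∈A) with x ≟ e
        ... | yes refl = inj₁ (x∈p∪q⁺ (inj₂ (x∈⁅x⁆ e)))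
        ... | no x≢e   = inj₂ (x∈p∧x∉q⇒x∈p─q x∈A (x≢y⇒x∉⁅y⁆ x≢e))
        toOld : ∀ {x} → x ∈ C ∪ ⁅ e ⁆ ⊎ x ∈ A - e → (x ∈ C ⊎ x ∈ A) ⊎ x ≡ e
        toOld {x} (inj₁ x∈C∪e) with x∈p∪q⁻ C ⁅ e ⁆ x∈C∪e
        ... | inj₁ x∈C = inj₁ (inj₁ x∈C)
        ... | inj₂ x∈e = inj₂ (x∈⁅y⁆⇒x≡y e x∈e)
        toOld (inj₂ x∈A-e) = inj₁ (inj₂ (p─q⊆p A ⁅ e ⁆ x∈A-e))

  open Chosen

  wellFormed-right : ∀ {U C D e J} → Alt U C (D ∪ ⁅ e ⁆) J → WellFormedCall C (D ∪ ⁅ e ⁆) (J ─ C)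
  wellFormed-right {C = C} {J = J} (_ , _ , C∪J-config , alternative) = record
    { refuted      = λ {d} d∈ → let c , c∈ , _ , d#ᵢc = alternative d d∈ in c , split c∈ , proj₁ d#ᵢc
    ; conflictFree = λ px py → proj₂ C∪J-config _ _ (merge px) (merge py)
    }
    where
      split : ∀ {x} → x ∈ C ⊎ x ∈ J → x ∈ C ⊎ x ∈ J ─ C
      split (inj₁ x∈C) = inj₁ x∈C
      split {x} (inj₂ x∈J) with x ∈? C
      ... | yes x∈C = inj₁ x∈C
      ... | no x∉C  = inj₂ (x∈p∧x∉q⇒x∈p─q x∈J x∉C)
      merge : ∀ {x} → x ∈ C ⊎ x ∈ J ─ C → x ∈ C ∪ J
      merge (inj₁ x∈C)   = x∈p∪q⁺ (inj₁ x∈C)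
      merge (inj₂ x∈J─C) = x∈p∪q⁺ (inj₂ (p─q⊆p J C x∈J─C))

  wellFormed-initial : WellFormedCall ⁅ bot ⁆ ∅ ∅
  wellFormed-initial = record { refuted = λ d∈∅ → ⊥-elim (∉⊥ d∈∅) ; conflictFree = onlyBot }
    where
      isBot : ∀ {x} → x ∈ ⁅ bot ⁆ ⊎ x ∈ ∅ → x ≡ bot
      isBot (inj₁ x∈⁅bot⁆) = x∈⁅y⁆⇒x≡y bot x∈⁅bot⁆
      isBot (inj₂ x∈∅)     = ⊥-elim (∉⊥ x∈∅)
      onlyBot : ConflictFree (λ x → x ∈ ⁅ bot ⁆ ⊎ x ∈ ∅)
      onlyBot px py with isBot px | isBot py
      ... | refl | refl = #-irrefl bot

  WellFormed : Frame → Set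
  WellFormed (frame C D A (entry _))  = WellFormedCall C D A
  WellFormed (frame _ _ _ (afterL _)) = ⊤
  WellFormed (frame _ _ _ (afterR _)) = ⊤

  step-wellFormed : ∀ {s s'} → s ⟶ s' → All WellFormed (stack s) → All WellFormed (stack s')
  step-wellFormed (step-return _ _)    (_  ∷ wfs) = wfs
  step-wellFormed (step-left _ _ ch)   (wf ∷ wfs) = wellFormed-left wf ch ∷ tt ∷ wfs
  step-wellFormed (step-right _ alt)   (_  ∷ wfs) = wellFormed-right alt ∷ tt ∷ wfs
  step-wellFormed (step-noalt _)       (_  ∷ wfs) = tt ∷ wfs
  step-wellFormed (step-cleanup _ _)   (_  ∷ wfs) = wfs

  slack : Subset n → Subset n → ℕ
  slack C D = ∣ ∁ C ∣ + ∣ ∁ D ∣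

  frameCost : Frame → ℕ
  frameCost (frame C D _ (entry _))  = budget (slack C D)
  frameCost (frame C D _ (afterL e)) = 2 + budget (slack C (D ∪ ⁅ e ⁆))
  frameCost (frame _ _ _ (afterR _)) = 1

  stackCost : State → ℕ
  stackCost s = sum (map frameCost (stack s))

  step-decreases : ∀ {s s'} → s ⟶ s' → All WellFormed (stack s) → stackCost s' < stackCost s
  step-decreases (step-return {C = C} {D = D} _ _) _ = m<n+m _ (budget-pos (slack C D))
  step-decreases {s} (step-left {C = C} {D = D} {fs = fs} e _ ch) (wf ∷ _) =
    subst (_< stackCost s) (+-assoc leftCall pendingRight (sum (map frameCost fs)))
          (+-monoˡ-< _ (budget-split left< right<))
    where
      leftCall     = budget (slack (C ∪ ⁅ e ⁆) D)
      pendingRight = 2 + budget (slack C (D ∪ ⁅ e ⁆))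
      left<  : slack (C ∪ ⁅ e ⁆) D < slack C D
      left<  = +-monoˡ-< ∣ ∁ D ∣ (∣∁p∪⁅x⁆∣<∣∁p∣ (chosen∉C ch))
      right< : slack C (D ∪ ⁅ e ⁆) < slack C D
      right< = +-monoʳ-< ∣ ∁ C ∣ (∣∁p∪⁅x⁆∣<∣∁p∣ (chosen∉D wf ch))
  step-decreases (step-right _ _)   _ = s≤s (≤-reflexive (+-suc _ _))
  step-decreases (step-noalt {C = C} {D = D} {e = e} _) _ =
    s≤s (s≤s (m≤n+m _ (budget (slack C (D ∪ ⁅ e ⁆)))))
  step-decreases (step-cleanup _ _) _ = ≤-refl

  accessible : ∀ k s → All WellFormed (stack s) → stackCost s < k → Acc (λ s' s → s ⟶ s') s
  accessible (suc k) s wfs cost<k = acc λ step →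
    accessible k _ (step-wellFormed step wfs) (<-≤-trans (step-decreases step wfs) (s≤s⁻¹ cost<k))

  allExecutionsFinite : AllExecutionsFinite
  allExecutionsFinite = accessible _ initial (wellFormed-initial ∷ []) ≤-refl

  IsBinaryTree-swap : ∀ {B L R r} → IsBinaryTree B L R r → IsBinaryTree B R L r
  IsBinaryTree-swap T = record
    { root∈         = root∈
    ; src∈          = λ b b' e → src∈ b b' (swap e)
    ; tgt∈          = λ b b' e → tgt∈ b b' (swap e)
    ; root-noparent = λ b e → root-noparent b (swap e)
    ; parent        = λ b' b'∈B b'≢r → Product.map₂ swap (parent b' b'∈B b'≢r)
    ; parent-unique = λ b₁ b₂ b' e₁ e₂ → parent-unique b₁ b₂ b' (swap e₁) (swap e₂)
    ; not-both      = λ b b' r l → not-both b b' l r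
    ; left-unique   = right-unique
    ; right-unique  = left-unique
    ; reachable     = λ b b∈B → Star.map swap (reachable b b∈B)
    }
    where open IsBinaryTree T

  IsBinaryTree-singleton : ∀ r → IsBinaryTree (r ∷ []) [] [] r
  IsBinaryTree-singleton r = record
    { root∈         = here refl
    ; src∈          = λ { _ _ (inj₁ ()) ; _ _ (inj₂ ()) }
    ; tgt∈          = λ { _ _ (inj₁ ()) ; _ _ (inj₂ ()) }
    ; root-noparent = λ { _ (inj₁ ()) ; _ (inj₂ ()) }
    ; parent        = λ { _ (here refl) r≢r → ⊥-elim (r≢r refl) }
    ; parent-unique = λ { _ _ _ (inj₁ ()) _ ; _ _ _ (inj₂ ()) _ }
    ; not-both      = λ _ _ ()
    ; left-unique   = λ _ _ _ ()
    ; right-unique  = λ _ _ _ ()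
    ; reachable     = λ { _ (here refl) → ε }
    }

  module _ {B L R r q t} (T : IsBinaryTree B L R r) (q∈B : q ∈ₗ B) (t∉B : ¬ t ∈ₗ B) where
    open IsBinaryTree T

    IsBinaryTree-addLeft : (∀ t' → ¬ (q , t') ∈ₗ L) → IsBinaryTree (t ∷ B) ((q , t) ∷ L) R r
    IsBinaryTree-addLeft q-noLeft = record
      { root∈         = there root∈
      ; src∈          = src∈'
      ; tgt∈          = tgt∈'
      ; root-noparent = root-noparent'
      ; parent        = parent'
      ; parent-unique = parent-unique'
      ; not-both      = not-both'
      ; left-unique   = left-unique'
      ; right-unique  = right-unique
      ; reachable     = reachable'
      }
      where
        B' = t ∷ B
        L' = (q , t) ∷ L
        _▷'_ : Tuple → Tuple → Set
        _▷'_ = _▷_ B' L' R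

        old : ∀ {b b'} → _▷_ B L R b b' → b ▷' b'
        old = Sum.map₁ there

        classify : ∀ {b b'} → b ▷' b' → (b ≡ q × b' ≡ t) ⊎ _▷_ B L R b b'
        classify (inj₁ (here refl)) = inj₁ (refl , refl)
        classify (inj₁ (there l))   = inj₂ (inj₁ l)
        classify (inj₂ r)           = inj₂ (inj₂ r)

        src∈' : ∀ b b' → b ▷' b' → b ∈ₗ B'
        src∈' b b' e with classify e
        ... | inj₁ (refl , _) = there q∈B
        ... | inj₂ e'         = there (src∈ b b' e')

        tgt∈' : ∀ b b' → b ▷' b' → b' ∈ₗ B'
        tgt∈' b b' e with classify e
        ... | inj₁ (_ , refl) = here refl
        ... | inj₂ e'         = there (tgt∈ b b' e')

        root-noparent' : ∀ b → ¬ (b ▷' r)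
        root-noparent' b e with classify e
        ... | inj₁ (_ , r≡t) = t∉B (subst (_∈ₗ B) r≡t root∈)
        ... | inj₂ e'        = root-noparent b e'

        parent' : ∀ b' → b' ∈ₗ B' → b' ≢ r → ∃[ b ] (b ▷' b')
        parent' _  (here refl)  _    = q , inj₁ (here refl)
        parent' b' (there b'∈B) b'≢r = Product.map₂ old (parent b' b'∈B b'≢r)

        parent-unique' : ∀ b₁ b₂ b' → b₁ ▷' b' → b₂ ▷' b' → b₁ ≡ b₂
        parent-unique' b₁ b₂ b' e₁ e₂ with classify e₁ | classify e₂
        ... | inj₁ (refl , refl) | inj₁ (refl , refl) = refl
        ... | inj₁ (_ , refl)    | inj₂ e₂'           = ⊥-elim (t∉B (tgt∈ b₂ t e₂'))
        ... | inj₂ e₁'           | inj₁ (_ , refl)    = ⊥-elim (t∉B (tgt∈ b₁ t e₁'))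
        ... | inj₂ e₁'           | inj₂ e₂'           = parent-unique b₁ b₂ b' e₁' e₂'

        not-both' : ∀ b b' → (b , b') ∈ₗ L' → ¬ (b , b') ∈ₗ R
        not-both' _ _  (here refl) r = t∉B (tgt∈ q t (inj₂ r))
        not-both' b b' (there l)     = not-both b b' l

        left-unique' : ∀ b b₁ b₂ → (b , b₁) ∈ₗ L' → (b , b₂) ∈ₗ L' → b₁ ≡ b₂
        left-unique' _ _  _  (here refl) (here refl) = refl
        left-unique' _ _  b₂ (here refl) (there l)   = ⊥-elim (q-noLeft b₂ l)
        left-unique' _ b₁ _  (there l)   (here refl) = ⊥-elim (q-noLeft b₁ l)
        left-unique' b b₁ b₂ (there l₁)  (there l₂)  = left-unique b b₁ b₂ l₁ l₂

        reachable' : ∀ b → b ∈ₗ B' → Star _▷'_ r b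
        reachable' _ (here refl)  = Star.map old (reachable q q∈B) ◅◅ inj₁ (here refl) ◅ ε
        reachable' b (there b∈B) = Star.map old (reachable b b∈B)

  IsBinaryTree-addRight : ∀ {B L R r q t} → IsBinaryTree B L R r → q ∈ₗ B → ¬ t ∈ₗ B →
    (∀ t' → ¬ (q , t') ∈ₗ R) → IsBinaryTree (t ∷ B) L ((q , t) ∷ R) r
  IsBinaryTree-addRight T q∈B t∉B q-noRight =
    IsBinaryTree-swap (IsBinaryTree-addLeft (IsBinaryTree-swap T) q∈B t∉B q-noRight)

  Key : Set
  Key = Subset n × Subset n

  key : Tuple → Key
  key (C , D , _ , _) = C , D

  childKey : Side → Tuple → Key
  childKey left  (C , D , _ , e) = C ∪ ⁅ e ⁆ , D
  childKey right (C , D , _ , e) = C , D ∪ ⁅ e ⁆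

  KeyedEdges : Side → List (Tuple × Tuple) → Set
  KeyedEdges side E = ∀ {p t} → (p , t) ∈ₗ E → key t ≡ childKey side p

  attachChild : ∀ side {B L R r q t} → IsBinaryTree B L R r →
    KeyedEdges left L → KeyedEdges right R → q ∈ₗ B → key t ≡ childKey side q →
    (∀ {b} → b ∈ₗ B → key b ≢ key t) →
    let p = just (q , side)
    in IsBinaryTree (t ∷ B) (logL p t L) (logR p t R) r
       × KeyedEdges left (logL p t L) × KeyedEdges right (logR p t R)
  attachChild left {q = q} T keyedL keyedR q∈B t-key fresh =
    IsBinaryTree-addLeft T q∈B (λ t∈B → fresh t∈B refl)
      (λ t' l → fresh (IsBinaryTree.tgt∈ T q t' (inj₁ l)) (trans (keyedL l) (sym t-key))) ,
    (λ { (here refl) → t-key ; (there l) → keyedL l }) , keyedR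
  attachChild right {q = q} T keyedL keyedR q∈B t-key fresh =
    IsBinaryTree-addRight T q∈B (λ t∈B → fresh t∈B refl)
      (λ t' r → fresh (IsBinaryTree.tgt∈ T q t' (inj₂ r)) (trans (keyedR r) (sym t-key))) ,
    keyedL , (λ { (here refl) → t-key ; (there r) → keyedR r })

  -- Over-approximates the keys that a call on (C, D) and its descendants can log.
  Extends : Key → Key → Set
  Extends (C , D) (C' , D') = C ⊆ C' × D ⊆ D' × (∀ {x} → x ∈ C' → x ∉ D)

  Extends-refl : ∀ {C D} → (∀ {x} → x ∈ C → x ∉ D) → Extends (C , D) (C , D)
  Extends-refl C∩D≡∅ = (λ x∈C → x∈C) , (λ x∈D → x∈D) , C∩D≡∅

  Extends-left⁻ : ∀ {C D e C' D'} → Extends (C ∪ ⁅ e ⁆ , D) (C' , D') →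
    e ∈ C' × Extends (C , D) (C' , D')
  Extends-left⁻ {e = e} (C∪e⊆C' , D⊆D' , C'∩D≡∅) =
    C∪e⊆C' (x∈p∪q⁺ (inj₂ (x∈⁅x⁆ e))) , (λ x∈C → C∪e⊆C' (x∈p∪q⁺ (inj₁ x∈C))) , D⊆D' , C'∩D≡∅

  Extends-right⁻ : ∀ {C D e C' D'} → Extends (C , D ∪ ⁅ e ⁆) (C' , D') →
    e ∈ D' × e ∉ C' × Extends (C , D) (C' , D')
  Extends-right⁻ {e = e} (C⊆C' , D∪e⊆D' , C'∩D∪e≡∅) =
    D∪e⊆D' e∈D∪e , (λ e∈C' → C'∩D∪e≡∅ e∈C' e∈D∪e) ,
    C⊆C' , (λ x∈D → D∪e⊆D' (x∈p∪q⁺ (inj₁ x∈D))) , (λ x∈C' x∈D → C'∩D∪e≡∅ x∈C' (x∈p∪q⁺ (inj₁ x∈D)))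
    where
      e∈D∪e = x∈p∪q⁺ (inj₂ (x∈⁅x⁆ e))

  -- An afterL frame will still log, through its step (5), the keys of its right subcall.
  Future : Frame → Key → Set
  Future (frame C D _ (entry _))  = Extends (C , D)
  Future (frame C D _ (afterL e)) = Extends (C , D ∪ ⁅ e ⁆)
  Future (frame _ _ _ (afterR _)) = λ _ → ⊥

  DisjointFutures : Frame → Frame → Set
  DisjointFutures f g = ∀ {k} → Future f k → ¬ Future g k

  ParentLogged : List Tuple → Frame → Set
  ParentLogged B (frame _ _ _ (entry nothing))          = ⊥
  ParentLogged B (frame C D _ (entry (just (q , side)))) = q ∈ₗ B × (C , D) ≡ childKey side q
  ParentLogged B (frame C D A (afterL e))               = (C , D , A , e) ∈ₗ B
  ParentLogged B (frame _ _ _ (afterR _))               = ⊤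

  ParentLogged-∷ : ∀ {B t} f → ParentLogged B f → ParentLogged (t ∷ B) f
  ParentLogged-∷ (frame _ _ _ (entry nothing))    ()
  ParentLogged-∷ (frame _ _ _ (entry (just _)))   = Product.map₁ there
  ParentLogged-∷ (frame _ _ _ (afterL _))         = there
  ParentLogged-∷ (frame _ _ _ (afterR _))         = _

  Unvisited : List Tuple → Frame → Set
  Unvisited B f = ∀ {b} → b ∈ₗ B → ¬ Future f (key b)

  FrameInv : List Tuple → Frame → Set
  FrameInv B f = ParentLogged B f × Unvisited B f

  FrameInv-∷ : ∀ {B t} f g → Future f (key t) → DisjointFutures f g → FrameInv B g →
    FrameInv (t ∷ B) g
  FrameInv-∷ _ g t∈f f∩g≡∅ (logged , unvisited) =
    ParentLogged-∷ g logged , λ { (here refl) → f∩g≡∅ t∈f ; (there b∈B) → unvisited b∈B }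

  root : Ev → Tuple
  root e₀ = ⁅ bot ⁆ , ∅ , ∅ , e₀

  record CallTree (e₀ : Ev) (B : List Tuple) (L R : List (Tuple × Tuple)) (stk : List Frame) : Set where
    field
      isTree   : IsBinaryTree B L R (root e₀)
      keyedL   : KeyedEdges left L
      keyedR   : KeyedEdges right R
      frames   : All (FrameInv B) stk
      disjoint : AllPairs DisjointFutures stk

  open CallTree

  CallTree-singleton : ∀ e₀ → CallTree e₀ (root e₀ ∷ []) [] [] []
  CallTree-singleton e₀ = record
    { isTree = IsBinaryTree-singleton (root e₀) ; keyedL = λ () ; keyedR = λ ()
    ; frames = [] ; disjoint = [] }

  restack : ∀ {e₀ B L R stk stk'} → CallTree e₀ B L R stk →
    All (FrameInv B) stk' → AllPairs DisjointFutures stk' → CallTree e₀ B L R stk'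
  restack ct invs disjoint = record
    { isTree = isTree ct ; keyedL = keyedL ct ; keyedR = keyedR ct ; frames = invs ; disjoint = disjoint }

  logNode : ∀ {e₀ B L R C D A p fs e} → (∀ {x} → x ∈ C → x ∉ D) →
    CallTree e₀ B L R (frame C D A (entry p) ∷ fs) →
    let t = (C , D , A , e) in CallTree e₀ (t ∷ B) (logL p t L) (logR p t R) fs
  logNode {p = nothing} _ record { frames = (() , _) ∷ _ }
  logNode {B = B} {C = C} {D = D} {A = A} {p = just (q , side)} {e = e} C∩D≡∅
    record { isTree = T ; keyedL = keyedL ; keyedR = keyedR
           ; frames = ((q∈B , t-key) , unvisited) ∷ invs ; disjoint = top∩fs ∷ disjoint }
    = let T' , keyedL' , keyedR' = attachChild side T keyedL keyedR q∈B t-key fresh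
      in record
        { isTree   = T'
        ; keyedL   = keyedL'
        ; keyedR   = keyedR'
        ; frames   = All.zipWith extend (top∩fs , invs)
        ; disjoint = disjoint
        }
    where
      ownKey : Extends (C , D) (C , D)
      ownKey = Extends-refl C∩D≡∅
      extend : ∀ {g} → DisjointFutures (frame C D A (entry (just (q , side)))) g × FrameInv B g →
        FrameInv ((C , D , A , e) ∷ B) g
      extend (top∩g , inv) = FrameInv-∷ (frame C D A (entry (just (q , side)))) _ ownKey top∩g inv
      fresh : ∀ {b} → b ∈ₗ B → key b ≢ (C , D)
      fresh b∈B b-key = unvisited b∈B (subst (Extends (C , D)) (sym b-key) ownKey)

  pushCalls : ∀ {e₀ B L R C D A p e fs} → e ∉ C → e ∉ D →
    let t = (C , D , A , e) ; top = frame C D A (entry p) in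
    Unvisited B top → All (DisjointFutures top) fs →
    CallTree e₀ (t ∷ B) L R fs →
    CallTree e₀ (t ∷ B) L R (frame (C ∪ ⁅ e ⁆) D (A - e) (entry (just (t , left)))
                            ∷ frame C D A (afterL e) ∷ fs)
  pushCalls {B = B} {C = C} {D} {A} {p} {e} e∉C e∉D unvisited top∩fs ct =
    restack ct (((here refl , refl) , leftUnvisited) ∷ (here refl , rightUnvisited) ∷ frames ct)
               ( (left∩right ∷ All.map (λ {g} → narrowLeft {g}) top∩fs)
               ∷ All.map (λ {g} → narrowRight {g}) top∩fs
               ∷ disjoint ct)
    where
      t = (C , D , A , e)
      top = frame C D A (entry p)
      leftCall = frame (C ∪ ⁅ e ⁆) D (A - e) (entry (just (t , left)))
      pendingRight = frame C D A (afterL e)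

      leftUnvisited : Unvisited (t ∷ B) leftCall
      leftUnvisited (here refl)  ext = e∉C (proj₁ (Extends-left⁻ ext))
      leftUnvisited (there b∈B) ext = unvisited b∈B (proj₂ (Extends-left⁻ ext))
      rightUnvisited : Unvisited (t ∷ B) pendingRight
      rightUnvisited (here refl)  ext = e∉D (proj₁ (Extends-right⁻ ext))
      rightUnvisited (there b∈B) ext = unvisited b∈B (proj₂ (proj₂ (Extends-right⁻ ext)))

      left∩right : DisjointFutures leftCall pendingRight
      left∩right ext-l ext-r = proj₁ (proj₂ (Extends-right⁻ ext-r)) (proj₁ (Extends-left⁻ ext-l))
      narrowLeft : ∀ {g} → DisjointFutures top g → DisjointFutures leftCall g
      narrowLeft top∩g ext = top∩g (proj₂ (Extends-left⁻ ext))
      narrowRight : ∀ {g} → DisjointFutures top g → DisjointFutures pendingRight g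
      narrowRight top∩g ext = top∩g (proj₂ (proj₂ (Extends-right⁻ ext)))

  CallTreeAt : State → Set
  CallTreeAt s = ∃[ e₀ ] CallTree e₀ (nodes s) (edgesL s) (edgesR s) (stack s)

  step-initial : ∀ {s} → initial ⟶ s → CallTreeAt s
  step-initial (step-return _ _)  = bot , CallTree-singleton bot
  step-initial (step-left e _ ch) =
    e , pushCalls {p = nothing} (chosen∉C ch) (chosen∉D wellFormed-initial ch)
                  (λ ()) [] (CallTree-singleton e)

  step-callTree : ∀ {s s'} → s ⟶ s' → All WellFormed (stack s) → CallTreeAt s → CallTreeAt s'
  step-callTree (step-return _ _) (wf ∷ _) (e₀ , ct) = e₀ , logNode (∈C⇒∉D wf) ct
  step-callTree (step-left {p = p} e _ ch) (wf ∷ _) (e₀ , ct) =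
    e₀ , pushCalls {p = p} (chosen∉C ch) (chosen∉D wf ch) (proj₂ (All.head (frames ct)))
                   (AllPairs.head (disjoint ct)) (logNode (∈C⇒∉D wf) ct)
  step-callTree (step-right _ _) _
    (e₀ , ct@record { frames = (logged , unvisited) ∷ invs ; disjoint = top∩fs ∷ disjoint }) =
    e₀ , restack ct (((logged , refl) , unvisited) ∷ (tt , λ _ ()) ∷ invs)
                    (((λ _ ()) ∷ top∩fs) ∷ All.tabulate (λ _ ()) ∷ disjoint)
  step-callTree (step-noalt _) _
    (e₀ , ct@record { frames = _ ∷ invs ; disjoint = _ ∷ disjoint }) =
    e₀ , restack ct ((tt , λ _ ()) ∷ invs) (All.tabulate (λ _ ()) ∷ disjoint)
  step-callTree (step-cleanup _ _) _
    (e₀ , ct@record { frames = _ ∷ invs ; disjoint = _ ∷ disjoint }) =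
    e₀ , restack ct invs disjoint

  callTree-preserved : ∀ {s s'} → Star _⟶_ s s' → All WellFormed (stack s) → CallTreeAt s →
    CallTreeAt s'
  callTree-preserved ε               _   ct = ct
  callTree-preserved (step ◅ steps) wfs ct =
    callTree-preserved steps (step-wellFormed step wfs) (step-callTree step wfs ct)

  binaryTree : ∀ s → Reachable s → Finished s →
    ∃[ e₀ ] IsBinaryTree (nodes s) (edgesL s) (edgesR s) (root e₀)
  binaryTree s ε ()
  binaryTree s (step ◅ steps) _ =
    Product.map₂ isTree
      (callTree-preserved steps (step-wellFormed step (wellFormed-initial ∷ [])) (step-initial step))

corollary2 : (𝔘 : EventStructure) →
    let open EventStructure 𝔘 using (bot)
        open Explore 𝔘
    in AllExecutionsFinite
       × (∀ s → Reachable s → Finished s →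
            ∃[ e₀ ] IsBinaryTree (nodes s) (edgesL s) (edgesR s) (⁅ bot ⁆ , ∅ , ∅ , e₀))
corollary2 𝔘 = allExecutionsFinite , binaryTree
  where open CallGraph 𝔘
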